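{- Let $G=(V,E)$ be a finite simple connected graph, $q\in V$, and let $f$ be a maximum $G$-parking function with respect to $q$. Then $f$ is the unique maximum $G$-parking function with respect to $q$ if and only if $f(v)\in\{ -1,0\}$ for all $v\in V$.
   Context: For $A\subseteq V$ and $v\in A$, $d_{\overline{A}}(v)$ denotes the number of edges $vw$ with $w\notin A$. A $G$-parking function with respect to $q$ is a function $f:V\to\mathbb{Z}_{\geq -1}$ with $f(q)=-1$ such that for every non-empty $A\subseteq V\setminus\{q\}$ there exists $v\in A$ with $0\leq f(v)<d_{\overline{A}}(v)$. A maximum $G$-parking function is one maximizing $\sum_{v\in V}f(v)$ among all $G$-parking functions with respect to $q$. -}

module Defs where

open import Data.Nat using (ℕ; suc)
open import Data.Bool using (Bool; true; false)
open import Data.Fin using (Fin; zero; suc)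
open import Data.Fin.Subset using (Subset; _∈_; _∉_; ∁; _∩_; ∣_∣; Nonempty)
open import Data.Vec using (tabulate)
open import Data.Integer using (ℤ; +_; -[1+_]; _+_; _≤_; _<_; 0ℤ)
open import Data.Product using (Σ; _×_; ∃)
open import Relation.Binary.PropositionalEquality using (_≡_)

record SimpleGraph (n : ℕ) : Set where
  field
    adj   : Fin n → Fin n → Bool
    sym   : ∀ u v → adj u v ≡ adj v u
    irrefl : ∀ v → adj v v ≡ false
open SimpleGraph public

data Reachable {n : ℕ} (G : SimpleGraph n) : Fin n → Fin n → Set where
  here : ∀ {v} → Reachable G v v
  step : ∀ {u w v} → adj G u w ≡ true → Reachable G w v → Reachable G u v

Connected : {n : ℕ} → SimpleGraph n → Set
Connected G = ∀ u v → Reachable G u v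

N : {n : ℕ} → SimpleGraph n → Fin n → Subset n
N G v = tabulate (adj G v)

dOut : {n : ℕ} → SimpleGraph n → Subset n → Fin n → ℕ
dOut G A v = ∣ ∁ A ∩ N G v ∣

minusOne : ℤ
minusOne = -[1+ 0 ]

IsParking : {n : ℕ} → SimpleGraph n → Fin n → (Fin n → ℤ) → Set
IsParking {n} G q f =
  (∀ v → minusOne ≤ f v) ×
  (f q ≡ minusOne) ×
  (∀ (A : Subset n) → Nonempty A → q ∉ A →
     Σ (Fin n) λ v → v ∈ A × (0ℤ ≤ f v) × (f v < + dOut G A v))

sumV : {n : ℕ} → (Fin n → ℤ) → ℤ
sumV {ℕ.zero} f = 0ℤ
sumV {suc n} f = f zero + sumV (λ i → f (suc i))

IsMaxParking : {n : ℕ} → SimpleGraph n → Fin n → (Fin n → ℤ) → Set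
IsMaxParking G q f =
  IsParking G q f × (∀ g → IsParking G q g → sumV g ≤ sumV f)

-- Dhar's burning algorithm: f is a G-parking function iff the vertices can be ranked,
-- starting from q, so that every other vertex w has more than f w neighbours of smaller
-- rank. If f v ≥ 1, let u be the last such neighbour of v and move v to just before u:
-- v loses only the neighbour u, u gains the neighbour v, and nobody else loses one, so
-- f + e_u − e_v is a parking function with the same sum. Conversely, if f only takes
-- the values −1 and 0, it lies pointwise below every parking function.

module Submission where

open import Defs
open import Data.Nat using (ℕ)
open import Data.Fin using (Fin)
open import Data.Integer using (ℤ; 0ℤ)
open import Data.Sum using (_⊎_)
open import Function.Bundles using (_⇔_)
open import Relation.Binary.PropositionalEquality using (_≡_)

open import Data.Bool using (Bool; true; if_then_else_)
open import Data.Bool.Properties using (T-≡)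
open import Data.Fin using (zero; suc)
open import Data.Fin.Properties using (_≟_; any?)
open import Data.Fin.Subset
  using (Subset; _∈_; _∉_; ∁; _∩_; _∪_; ∣_∣; Nonempty; ⁅_⁆; _⊆_; _⊂_; _⊃_; inside; outside)
open import Data.Fin.Subset.Properties
open import Data.Fin.Subset.Induction using (⊃-wellFounded)
open import Data.Integer using (_+_; _≤_; _<_; +_; +[1+_]; -[1+_]; +≤+; +<+; -≤+; -≤-)
import Data.Integer as ℤ
import Data.Integer.Properties as ℤP
open import Algebra.Properties.CommutativeSemigroup ℤP.+-commutativeSemigroup using (x∙yz≈y∙xz)
open import Data.Nat using (zero; suc; _<ᵇ_; _<?_; s≤s; z≤n)
import Data.Nat as ℕ
import Data.Nat.Properties as ℕP
open import Data.Nat.Induction using (<-wellFounded)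
open import Data.Product using (Σ; ∃; _×_; _,_; proj₁; proj₂)
open import Function using (_∘_)
open import Data.Sum using (inj₁; inj₂)
open import Data.Vec using (_∷_; []; tabulate)
open import Data.Vec.Functional using (updateAt)
open import Data.Vec.Functional.Properties using (updateAt-updates; updateAt-minimal)
open import Data.Vec.Properties using (lookup∘tabulate; []=⇒lookup; lookup⇒[]=)
open import Function.Bundles using (mk⇔; Equivalence)
open import Function.Definitions using (Injective)
open import Induction.WellFounded using (Acc; acc)
open import Relation.Nullary using (Dec; yes; no; contradiction)
open import Relation.Nullary.Decidable using (_×-dec_; ¬?; does)
import Relation.Binary.PropositionalEquality as ≡
open import Relation.Binary.PropositionalEquality
  using (_≢_; refl; trans; cong; subst; subst₂; module ≡-Reasoning)

private
  variable
    n : ℕ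
    B : Subset n
    G : SimpleGraph n
    q u v w x : Fin n
    f g : Fin n → ℤ

∈-tabulate⁺ : (p : Fin n → Bool) → p x ≡ true → x ∈ tabulate p
∈-tabulate⁺ {x = x} p px = lookup⇒[]= x (tabulate p) (trans (lookup∘tabulate p x) px)

∈-tabulate⁻ : (p : Fin n → Bool) → x ∈ tabulate p → p x ≡ true
∈-tabulate⁻ {x = x} p x∈ = trans (≡.sym (lookup∘tabulate p x)) ([]=⇒lookup x∈)

∩-monoˡ : {p p′ : Subset n} (r : Subset n) → p ⊆ p′ → p ∩ r ⊆ p′ ∩ r
∩-monoˡ r p⊆p′ x∈p∩r with x∈p∩q⁻ _ r x∈p∩r
... | x∈p , x∈r = x∈p∩q⁺ (p⊆p′ x∈p , x∈r)

∣p∪q∣≤∣p∣+∣q∣ : (p r : Subset n) → ∣ p ∪ r ∣ ℕ.≤ ∣ p ∣ ℕ.+ ∣ r ∣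
∣p∪q∣≤∣p∣+∣q∣ [] [] = z≤n
∣p∪q∣≤∣p∣+∣q∣ (outside ∷ p) (outside ∷ r) = ∣p∪q∣≤∣p∣+∣q∣ p r
∣p∪q∣≤∣p∣+∣q∣ (outside ∷ p) (inside ∷ r) =
  subst (∣ p ∪ r ∣ ℕ.<_) (≡.sym (ℕP.+-suc ∣ p ∣ ∣ r ∣)) (s≤s (∣p∪q∣≤∣p∣+∣q∣ p r))
∣p∪q∣≤∣p∣+∣q∣ (inside ∷ p) (outside ∷ r) = s≤s (∣p∪q∣≤∣p∣+∣q∣ p r)
∣p∪q∣≤∣p∣+∣q∣ (inside ∷ p) (inside ∷ r) =
  s≤s (ℕP.≤-trans (∣p∪q∣≤∣p∣+∣q∣ p r) (ℕP.+-monoʳ-≤ ∣ p ∣ (ℕP.n≤1+n ∣ r ∣)))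

∃-∈-≢ : (p : Subset n) (x : Fin n) → 1 ℕ.< ∣ p ∣ → ∃ λ y → y ∈ p × y ≢ x
∃-∈-≢ p x 1<∣p∣ with any? (λ y → (y ∈? p) ×-dec ¬? (y ≟ x))
... | yes found = found
... | no none = contradiction (p⊆q⇒∣p∣≤∣q∣ p⊆⁅x⁆)
  (ℕP.<⇒≱ (subst (ℕ._< ∣ p ∣) (≡.sym (∣⁅x⁆∣≡1 x)) 1<∣p∣))
  where
  p⊆⁅x⁆ : p ⊆ ⁅ x ⁆
  p⊆⁅x⁆ {y} y∈p with y ≟ x
  ... | yes refl = x∈⁅x⁆ x
  ... | no y≢x = contradiction (y , y∈p , y≢x) none

argmin : (μ : Fin n → ℕ) (A : Subset n) → Nonempty A → ∃ λ w → w ∈ A × (∀ {y} → y ∈ A → μ w ℕ.≤ μ y)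
argmin μ A (a , a∈A) = descend a a∈A (<-wellFounded (μ a))
  where
  descend : ∀ a → a ∈ A → Acc ℕ._<_ (μ a) → ∃ λ w → w ∈ A × (∀ {y} → y ∈ A → μ w ℕ.≤ μ y)
  descend a a∈A (acc smaller) with any? (λ y → (y ∈? A) ×-dec (μ y <? μ a))
  ... | yes (y , y∈A , μy<μa) = descend y y∈A (smaller μy<μa)
  ... | no none = a , a∈A , λ {y} y∈A → ℕP.≮⇒≥ (λ μy<μa → none (y , y∈A , μy<μa))

sumV-mono-≤ : (∀ i → f i ≤ g i) → sumV f ≤ sumV g
sumV-mono-≤ {zero} f≤g = ℤP.≤-refl
sumV-mono-≤ {suc n} f≤g = ℤP.+-mono-≤ (f≤g zero) (sumV-mono-≤ (λ i → f≤g (suc i)))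

sumV-mono-< : (∀ i → f i ≤ g i) → ∀ i → f i < g i → sumV f < sumV g
sumV-mono-< {suc n} f≤g zero f0<g0 = ℤP.+-mono-<-≤ f0<g0 (sumV-mono-≤ (λ i → f≤g (suc i)))
sumV-mono-< {suc n} f≤g (suc i) fi<gi =
  ℤP.+-mono-≤-< (f≤g zero) (sumV-mono-< (λ j → f≤g (suc j)) i fi<gi)

pointwise-≤∧sumV-≥⇒≡ : (∀ i → f i ≤ g i) → sumV g ≤ sumV f → ∀ i → g i ≡ f i
pointwise-≤∧sumV-≥⇒≡ f≤g Σg≤Σf i =
  ℤP.≤-antisym (ℤP.≮⇒≥ (λ fi<gi → ℤP.<⇒≱ (sumV-mono-< f≤g i fi<gi) Σg≤Σf)) (f≤g i)

sumV-updateAt : (f : Fin n → ℤ) (i : Fin n) (c : ℤ) → sumV (updateAt f i (λ x → c + x)) ≡ c + sumV f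
sumV-updateAt {suc n} f zero c = ℤP.+-assoc c (f zero) _
sumV-updateAt {suc n} f (suc i) c =
  trans (cong (λ s → f zero + s) (sumV-updateAt (λ j → f (suc j)) i c)) (x∙yz≈y∙xz (f zero) c _)

-- Burning orders

earlier : (Fin n → ℕ) → Fin n → Subset n
earlier rank w = tabulate (λ y → rank y <ᵇ rank w)

module _ (rank : Fin n → ℕ) where

  ∈-earlier⁺ : ∀ {y} → rank y ℕ.< rank w → y ∈ earlier rank w
  ∈-earlier⁺ ry<rw = ∈-tabulate⁺ _ (Equivalence.to T-≡ (ℕP.<⇒<ᵇ ry<rw))

  ∈-earlier⁻ : ∀ {y} → y ∈ earlier rank w → rank y ℕ.< rank w
  ∈-earlier⁻ {w} {y} y∈ = ℕP.<ᵇ⇒< (rank y) (rank w) (Equivalence.from T-≡ (∈-tabulate⁻ _ y∈))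

earlier-mono : ∀ {rank rank′} → (∀ {y} → rank y ℕ.< rank w → rank′ y ℕ.< rank′ w)
  → earlier rank w ⊆ earlier rank′ w
earlier-mono {rank = rank} {rank′} mono y∈ = ∈-earlier⁺ rank′ (mono (∈-earlier⁻ rank y∈))

earlierNeighbours : SimpleGraph n → (Fin n → ℕ) → Fin n → Subset n
earlierNeighbours G rank w = earlier rank w ∩ N G w

-- w burns once the fire reaches it along more than f w edges.
record Burns (G : SimpleGraph n) (f : Fin n → ℤ) (rank : Fin n → ℕ) (w : Fin n) : Set where
  constructor burning
  field
    nonnegative : 0ℤ ≤ f w
    exceeded    : f w < + ∣ earlierNeighbours G rank w ∣

Burns-mono : ∀ {rank rank′} → (∀ {y} → rank y ℕ.< rank w → rank′ y ℕ.< rank′ w)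
  → Burns G f rank w → Burns G f rank′ w
Burns-mono {w = w} {G = G} {rank = rank} {rank′} mono (burning 0≤fw fw<) =
  burning 0≤fw (ℤP.<-≤-trans fw< (+≤+ (p⊆q⇒∣p∣≤∣q∣ (∩-monoˡ (N G w) earlier⊆earlier′))))
  where
  earlier⊆earlier′ : earlier rank w ⊆ earlier rank′ w
  earlier⊆earlier′ = earlier-mono {rank = rank} {rank′} mono

Burns-cong : ∀ {rank} → g w ≡ f w → Burns G f rank w → Burns G g rank w
Burns-cong gw≡fw (burning 0≤fw fw<) =
  burning (subst (0ℤ ≤_) (≡.sym gw≡fw) 0≤fw) (subst (_< _) (≡.sym gw≡fw) fw<)

Burns-suc : ∀ {rank rank′} → earlierNeighbours G rank w ⊂ earlierNeighbours G rank′ w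
  → Burns G f rank w → g w ≡ ℤ.suc (f w) → Burns G g rank′ w
Burns-suc ⊂ (burning 0≤fw fw<) gw≡ = burning
  (subst (0ℤ ≤_) (≡.sym gw≡) (ℤP.i≤j⇒i≤1+j 0≤fw))
  (subst (_< _) (≡.sym gw≡) (ℤP.≤-<-trans (ℤP.i<j⇒suc[i]≤j fw<) (+<+ (p⊂q⇒∣p∣<∣q∣ ⊂))))

burning⇒isParking : (rank : Fin n → ℕ) → (∀ v → minusOne ≤ f v) → f q ≡ minusOne
  → (∀ w → w ≢ q → Burns G f rank w) → IsParking G q f
burning⇒isParking {n} {f} {q} {G} rank lb fq burns = lb , fq , witness
  where
  witness : ∀ A → Nonempty A → q ∉ A → Σ (Fin n) λ w → w ∈ A × 0ℤ ≤ f w × f w < + dOut G A w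
  witness A nonempty q∉A with argmin rank A nonempty
  ... | w , w∈A , w-first with burns w (λ { refl → q∉A w∈A })
  ...   | burning 0≤fw fw< =
    w , w∈A , 0≤fw , ℤP.<-≤-trans fw< (+≤+ (p⊆q⇒∣p∣≤∣q∣ (∩-monoˡ (N G w) earlier⊆∁A)))
    where
    earlier⊆∁A : earlier rank w ⊆ ∁ A
    earlier⊆∁A y∈ = x∉p⇒x∈∁p (λ y∈A → ℕP.<⇒≱ (∈-earlier⁻ rank y∈) (w-first y∈A))

record BurningOrder (G : SimpleGraph n) (q : Fin n) (f : Fin n → ℤ) : Set where
  field
    rank           : Fin n → ℕ
    rank-q         : rank q ≡ 0
    rank-injective : Injective _≡_ _≡_ rank
    burns          : ∀ w → w ≢ q → Burns G f rank w

record PartialBurningOrder (G : SimpleGraph n) (q : Fin n) (f : Fin n → ℤ) (B : Subset n)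
  : Set where
  field
    rank           : Fin n → ℕ
    bound          : ℕ
    q∈B            : q ∈ B
    rank-q         : rank q ≡ 0
    rank-<         : ∀ {x} → x ∈ B → rank x ℕ.< bound
    rank-∉         : ∀ {x} → x ∉ B → rank x ≡ bound
    rank-injective : ∀ {x y} → x ∈ B → y ∈ B → rank x ≡ rank y → x ≡ y
    burns          : ∀ {x} → x ∈ B → x ≢ q → Burns G f rank x

  burnt-before : ∀ {x y} → x ∈ B → rank y ℕ.< rank x → y ∈ B
  burnt-before {x} {y} x∈B ry<rx with y ∈? B
  ... | yes y∈B = y∈B
  ... | no y∉B = contradiction (rank-< x∈B) (ℕP.<-asym (subst (ℕ._< rank x) (rank-∉ y∉B) ry<rx))

  rank-≤ : ∀ x → rank x ℕ.≤ bound
  rank-≤ x with x ∈? B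
  ... | yes x∈B = ℕP.<⇒≤ (rank-< x∈B)
  ... | no x∉B = ℕP.≤-reflexive (rank-∉ x∉B)

bumpOutside : Subset n → (Fin n → ℕ) → Fin n → ℕ
bumpOutside B rank x = if does (x ∈? B) then rank x else ℕ.suc (rank x)

bumpOutside-∈ : ∀ rank → x ∈ B → bumpOutside B rank x ≡ rank x
bumpOutside-∈ {x = x} {B = B} rank x∈B with x ∈? B
... | yes _ = refl
... | no x∉B = contradiction x∈B x∉B

bumpOutside-∉ : ∀ rank → x ∉ B → bumpOutside B rank x ≡ ℕ.suc (rank x)
bumpOutside-∉ {x = x} {B = B} rank x∉B with x ∈? B
... | yes x∈B = contradiction x∈B x∉B
... | no _ = refl

module _ {G : SimpleGraph n} {q : Fin n} {f : Fin n → ℤ} where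

  startFire : PartialBurningOrder G q f ⁅ q ⁆
  startFire = record
    { rank           = rank
    ; bound          = 1
    ; q∈B            = x∈⁅x⁆ q
    ; rank-q         = bumpOutside-∈ _ (x∈⁅x⁆ q)
    ; rank-<         = λ x∈ → ℕP.≤-reflexive (cong ℕ.suc (bumpOutside-∈ _ x∈))
    ; rank-∉         = bumpOutside-∉ _
    ; rank-injective = λ x∈ y∈ _ → trans (x∈⁅y⁆⇒x≡y q x∈) (≡.sym (x∈⁅y⁆⇒x≡y q y∈))
    ; burns          = λ x∈ x≢q → contradiction (x∈⁅y⁆⇒x≡y q x∈) x≢q
    }
    where
    rank : Fin n → ℕ
    rank = bumpOutside ⁅ q ⁆ (λ _ → 0)

  -- w is burnt next; it takes the old common rank of the unburnt vertices.
  burnNext : PartialBurningOrder G q f B → w ∉ B → 0ℤ ≤ f w × f w < + dOut G (∁ B) w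
    → PartialBurningOrder G q f (B ∪ ⁅ w ⁆)
  burnNext {B = B} {w = w} P w∉B (0≤fw , fw<) = record
    { rank           = rank′
    ; bound          = ℕ.suc bound
    ; q∈B            = x∈p∪q⁺ (inj₁ q∈B)
    ; rank-q         = trans (rank′-old (x∈p∪q⁺ (inj₁ q∈B))) rank-q
    ; rank-<         = λ {x} x∈ → subst (ℕ._< ℕ.suc bound) (≡.sym (rank′-old x∈)) (s≤s (rank-≤ x))
    ; rank-∉         = λ x∉ → trans (bumpOutside-∉ rank x∉) (cong ℕ.suc (rank-∉ (x∉ ∘ old)))
    ; rank-injective = injective′
    ; burns          = burns′
    }
    where
    open PartialBurningOrder P
    B′ : Subset n
    B′ = B ∪ ⁅ w ⁆
    old : ∀ {x} → x ∈ B → x ∈ B′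
    old x∈B = x∈p∪q⁺ (inj₁ x∈B)
    rank′ : Fin n → ℕ
    rank′ = bumpOutside B′ rank
    rank′-old : ∀ {x} → x ∈ B′ → rank′ x ≡ rank x
    rank′-old = bumpOutside-∈ rank
    rank-w : rank w ≡ bound
    rank-w = rank-∉ w∉B
    cases : ∀ {x} → x ∈ B′ → x ∈ B ⊎ x ≡ w
    cases x∈ with x∈p∪q⁻ B ⁅ w ⁆ x∈
    ... | inj₁ x∈B = inj₁ x∈B
    ... | inj₂ x∈⁅w⁆ = inj₂ (x∈⁅y⁆⇒x≡y w x∈⁅w⁆)
    before-w : ∀ {x} → x ∈ B → rank′ x ℕ.< rank′ w
    before-w x∈B = subst₂ ℕ._<_ (≡.sym (rank′-old (old x∈B)))
      (≡.sym (trans (rank′-old (x∈p∪q⁺ (inj₂ (x∈⁅x⁆ w)))) rank-w)) (rank-< x∈B)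
    injective′ : ∀ {x y} → x ∈ B′ → y ∈ B′ → rank′ x ≡ rank′ y → x ≡ y
    injective′ x∈ y∈ eq with cases x∈ | cases y∈
    ... | inj₁ x∈B | inj₁ y∈B =
      rank-injective x∈B y∈B (trans (≡.sym (rank′-old x∈)) (trans eq (rank′-old y∈)))
    ... | inj₁ x∈B | inj₂ refl = contradiction eq (ℕP.<⇒≢ (before-w x∈B))
    ... | inj₂ refl | inj₁ y∈B = contradiction (≡.sym eq) (ℕP.<⇒≢ (before-w y∈B))
    ... | inj₂ refl | inj₂ refl = refl
    burns′ : ∀ {x} → x ∈ B′ → x ≢ q → Burns G f rank′ x
    burns′ x∈ x≢q with cases x∈
    ... | inj₁ x∈B = Burns-mono (stillEarlier x∈B) (burns x∈B x≢q)
      where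
      stillEarlier : ∀ {x y} → x ∈ B → rank y ℕ.< rank x → rank′ y ℕ.< rank′ x
      stillEarlier x∈B ry<rx = subst₂ ℕ._<_ (≡.sym (rank′-old (old (burnt-before x∈B ry<rx))))
        (≡.sym (rank′-old (old x∈B))) ry<rx
    ... | inj₂ refl =
      burning 0≤fw (ℤP.<-≤-trans fw< (+≤+ (p⊆q⇒∣p∣≤∣q∣ (∩-monoˡ (N G w) burnt⊆earlier))))
      where
      burnt⊆earlier : ∁ (∁ B) ⊆ earlier rank′ w
      burnt⊆earlier y∈ = ∈-earlier⁺ rank′ (before-w (x∉∁p⇒x∈p (x∈∁p⇒x∉p y∈)))

  burntOrder : PartialBurningOrder G q f B → (∀ x → x ∈ B) → BurningOrder G q f
  burntOrder P all-burnt = record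
    { rank           = rank
    ; rank-q         = rank-q
    ; rank-injective = rank-injective (all-burnt _) (all-burnt _)
    ; burns          = λ w → burns (all-burnt w)
    }
    where open PartialBurningOrder P

  burningOrder : IsParking G q f → BurningOrder G q f
  burningOrder (_ , _ , parking) = grow (⊃-wellFounded ⁅ q ⁆) startFire
    where
    grow : Acc _⊃_ B → PartialBurningOrder G q f B → BurningOrder G q f
    grow {B} (acc larger) P with nonempty? (∁ B)
    ... | no nothing-left = burntOrder P (λ x → x∉∁p⇒x∈p (λ x∈∁B → nothing-left (x , x∈∁B)))
    ... | yes unburnt with parking (∁ B) unburnt (x∈p⇒x∉∁p (PartialBurningOrder.q∈B P))
    ...   | w , w∈∁B , w-burns = grow (larger B⊂B′) (burnNext P w∉B w-burns)
      where
      w∉B : w ∉ B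
      w∉B = x∈∁p⇒x∉p w∈∁B
      B⊂B′ : B ⊂ B ∪ ⁅ w ⁆
      B⊂B′ = p⊆p∪q ⁅ w ⁆ , w , x∈p∪q⁺ (inj₂ (x∈⁅x⁆ w)) , w∉B

-- Doubling the ranks leaves room to place v between u and everything ranked below u.
moveJustBefore : (Fin n → ℕ) → Fin n → Fin n → Fin n → ℕ
moveJustBefore rank v u x = if does (x ≟ v) then 2 ℕ.* rank u else suc (2 ℕ.* rank x)

moveJustBefore-v : ∀ rank → moveJustBefore rank v u v ≡ 2 ℕ.* rank u
moveJustBefore-v {v = v} rank with v ≟ v
... | yes _ = refl
... | no v≢v = contradiction refl v≢v

moveJustBefore-≢ : ∀ rank → x ≢ v → moveJustBefore rank v u x ≡ suc (2 ℕ.* rank x)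
moveJustBefore-≢ {x = x} {v = v} rank x≢v with x ≟ v
... | yes x≡v = contradiction x≡v x≢v
... | no _ = refl

module _ {G : SimpleGraph n} {q : Fin n} {f : Fin n → ℤ} (parking : IsParking G q f)
         (order : BurningOrder G q f) where

  open BurningOrder order

  private
    S : Fin n → Subset n
    S = earlierNeighbours G rank

  f-q : f q ≡ minusOne
  f-q = proj₁ (proj₂ parking)

  positive⇒≢q : ∀ {k} → f v ≡ +[1+ k ] → v ≢ q
  positive⇒≢q fv refl with trans (≡.sym fv) f-q
  ... | ()

  1<∣S∣ : ∀ {k} → f v ≡ +[1+ k ] → 1 ℕ.< ∣ S v ∣
  1<∣S∣ {v} fv with burns v (positive⇒≢q fv)
  ... | burning _ fv< = ℕP.≤-trans (s≤s (s≤s z≤n)) (ℤP.drop‿+<+ (subst (_< + ∣ S v ∣) fv fv<))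

  lastEarlierNeighbour : Nonempty (S v) → ∃ λ u → u ∈ S v × (∀ {y} → y ∈ S v → rank y ℕ.≤ rank u)
  lastEarlierNeighbour {v} nonempty with argmin (λ y → rank v ℕ.∸ rank y) (S v) nonempty
  ... | u , u∈S , u-min = u , u∈S , λ y∈S → ℕP.≮⇒≥ (λ ru<ry →
        ℕP.<⇒≱ (ℕP.∸-monoʳ-< ru<ry (ℕP.<⇒≤ (∈-earlier⁻ rank (proj₁ (x∈p∩q⁻ _ _ y∈S))))) (u-min y∈S))

  module Shifted {v u : Fin n} {k : ℕ} (fv : f v ≡ +[1+ k ]) (u∈S : u ∈ S v)
    (u-last : ∀ {y} → y ∈ S v → rank y ℕ.≤ rank u) (u≢q : u ≢ q) where

    v≢q : v ≢ q
    v≢q = positive⇒≢q fv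

    ru<rv : rank u ℕ.< rank v
    ru<rv = ∈-earlier⁻ rank (proj₁ (x∈p∩q⁻ _ _ u∈S))

    u≢v : u ≢ v
    u≢v refl = ℕP.<-irrefl refl ru<rv

    rank′ : Fin n → ℕ
    rank′ = moveJustBefore rank v u

    rank′-v : rank′ v ≡ 2 ℕ.* rank u
    rank′-v = moveJustBefore-v rank

    rank′-≢ : x ≢ v → rank′ x ≡ suc (2 ℕ.* rank x)
    rank′-≢ = moveJustBefore-≢ rank

    f′ : Fin n → ℤ
    f′ = updateAt (updateAt f u ℤ.suc) v ℤ.pred

    f′-v : f′ v ≡ + k
    f′-v = trans (updateAt-updates v (updateAt f u ℤ.suc))
                (cong ℤ.pred (trans (updateAt-minimal v u f (u≢v ∘ ≡.sym)) fv))

    f′-u : f′ u ≡ ℤ.suc (f u)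
    f′-u = trans (updateAt-minimal u v _ u≢v) (updateAt-updates u f)

    f′-other : x ≢ u → x ≢ v → f′ x ≡ f x
    f′-other x≢u x≢v = trans (updateAt-minimal _ v _ x≢v) (updateAt-minimal _ u f x≢u)

    f′-v≢f-v : f′ v ≢ f v
    f′-v≢f-v f′v≡fv = ℤP.i≢suc[i] (trans (≡.sym f′-v) (trans f′v≡fv fv))

    sumV-f′ : sumV f′ ≡ sumV f
    sumV-f′ = begin
      sumV f′                          ≡⟨ sumV-updateAt (updateAt f u ℤ.suc) v ℤ.-1ℤ ⟩
      ℤ.pred (sumV (updateAt f u ℤ.suc)) ≡⟨ cong ℤ.pred (sumV-updateAt f u ℤ.1ℤ) ⟩
      ℤ.pred (ℤ.suc (sumV f))         ≡⟨ ℤP.pred-suc (sumV f) ⟩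
      sumV f                          ∎
      where open ≡-Reasoning

    stillEarlier : ∀ {w y} → w ≢ v → rank y ℕ.< rank w → rank′ y ℕ.< rank′ w
    stillEarlier {w} {y} w≢v ry<rw = byCases (y ≟ v)
      where
      byCases : Dec (y ≡ v) → rank′ y ℕ.< rank′ w
      byCases (yes refl) = subst₂ ℕ._<_ (≡.sym rank′-v) (≡.sym (rank′-≢ w≢v))
                             (s≤s (ℕP.*-monoʳ-≤ 2 (ℕP.<⇒≤ (ℕP.<-trans ru<rv ry<rw))))
      byCases (no y≢v) = subst₂ ℕ._<_ (≡.sym (rank′-≢ y≢v)) (≡.sym (rank′-≢ w≢v))
                           (s≤s (ℕP.*-monoʳ-< 2 ry<rw))

    burns-u : Burns G f′ rank′ u
    burns-u = Burns-suc (S⊆S′ , v , v∈S′u , v∉Su) (burns u u≢q) f′-u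
      where
      S⊆S′ : S u ⊆ earlierNeighbours G rank′ u
      S⊆S′ = ∩-monoˡ (N G u) (earlier-mono (stillEarlier u≢v))
      v∈S′u : v ∈ earlierNeighbours G rank′ u
      v∈S′u = x∈p∩q⁺
        ( ∈-earlier⁺ rank′ (subst₂ ℕ._<_ (≡.sym rank′-v) (≡.sym (rank′-≢ u≢v)) (ℕP.n<1+n _))
        , ∈-tabulate⁺ (adj G u)
            (trans (SimpleGraph.sym G u v) (∈-tabulate⁻ (adj G v) (proj₂ (x∈p∩q⁻ _ _ u∈S)))))
      v∉Su : v ∉ S u
      v∉Su v∈Su = ℕP.<-asym ru<rv (∈-earlier⁻ rank (proj₁ (x∈p∩q⁻ _ _ v∈Su)))

    burns-v : Burns G f′ rank′ v
    burns-v with burns v v≢q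
    ... | burning _ fv< =
      burning (subst (0ℤ ≤_) (≡.sym f′-v) (+≤+ z≤n)) (subst (_< + ∣ S′ ∣) (≡.sym f′-v) (+<+ k<∣S′∣))
      where
      S′ : Subset n
      S′ = earlierNeighbours G rank′ v
      S⊆S′∪u : S v ⊆ S′ ∪ ⁅ u ⁆
      S⊆S′∪u {y} y∈S with y ≟ u | x∈p∩q⁻ _ _ y∈S
      ... | yes refl | _ = x∈p∪q⁺ (inj₂ (x∈⁅x⁆ u))
      ... | no y≢u | y∈earlier , y∈N = x∈p∪q⁺ (inj₁ (x∈p∩q⁺ (∈-earlier⁺ rank′ r′y<r′v , y∈N)))
        where
        ry<ru : rank y ℕ.< rank u
        ry<ru = ℕP.≤∧≢⇒< (u-last y∈S) (λ ry≡ru → y≢u (rank-injective ry≡ru))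
        y≢v : y ≢ v
        y≢v refl = ℕP.<-irrefl refl (∈-earlier⁻ rank y∈earlier)
        r′y<r′v : rank′ y ℕ.< rank′ v
        r′y<r′v = subst₂ ℕ._≤_ (≡.trans (ℕP.*-suc 2 (rank y)) (≡.sym (cong suc (rank′-≢ y≢v))))
                    (≡.sym rank′-v) (ℕP.*-monoʳ-≤ 2 ry<ru)
      k<∣S′∣ : k ℕ.< ∣ S′ ∣
      k<∣S′∣ = ℕ.s≤s⁻¹ (begin
        suc (suc k)          ≤⟨ ℤP.drop‿+<+ (subst (_< + ∣ S v ∣) fv fv<) ⟩
        ∣ S v ∣              ≤⟨ p⊆q⇒∣p∣≤∣q∣ S⊆S′∪u ⟩
        ∣ S′ ∪ ⁅ u ⁆ ∣       ≤⟨ ∣p∪q∣≤∣p∣+∣q∣ S′ ⁅ u ⁆ ⟩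
        ∣ S′ ∣ ℕ.+ ∣ ⁅ u ⁆ ∣ ≡⟨ cong (∣ S′ ∣ ℕ.+_) (∣⁅x⁆∣≡1 u) ⟩
        ∣ S′ ∣ ℕ.+ 1         ≡⟨ ℕP.+-comm ∣ S′ ∣ 1 ⟩
        suc ∣ S′ ∣           ∎)
        where open ℕP.≤-Reasoning

    burns′ : ∀ w → w ≢ q → Burns G f′ rank′ w
    burns′ w w≢q with w ≟ u | w ≟ v
    ... | yes refl | _ = burns-u
    ... | no _ | yes refl = burns-v
    ... | no w≢u | no w≢v =
      Burns-cong (f′-other w≢u w≢v) (Burns-mono (stillEarlier w≢v) (burns w w≢q))

    f′-q : f′ q ≡ minusOne
    f′-q = trans (f′-other (u≢q ∘ ≡.sym) (v≢q ∘ ≡.sym)) f-q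

    f′≥-1 : ∀ x → minusOne ≤ f′ x
    f′≥-1 x with x ≟ q
    ... | yes refl = ℤP.≤-reflexive (≡.sym f′-q)
    ... | no x≢q = ℤP.≤-trans -≤+ (Burns.nonnegative (burns′ x x≢q))

    f′-isParking : IsParking G q f′
    f′-isParking = burning⇒isParking rank′ f′≥-1 f′-q burns′

  shiftChip : ∀ {k} → f v ≡ +[1+ k ] → ∃ λ f′ → IsParking G q f′ × sumV f′ ≡ sumV f × f′ v ≢ f v
  shiftChip {v} fv with ∃-∈-≢ (S v) q (1<∣S∣ fv)
  ... | y₀ , y₀∈S , y₀≢q with lastEarlierNeighbour (y₀ , y₀∈S)
  ...   | u , u∈S , u-last = f′ , f′-isParking , sumV-f′ , f′-v≢f-v
    where
    u≢q : u ≢ q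
    u≢q refl = y₀≢q (rank-injective (trans (ℕP.n≤0⇒n≡0 ry₀≤0) (≡.sym rank-q)))
      where
      ry₀≤0 : rank y₀ ℕ.≤ 0
      ry₀≤0 = subst (rank y₀ ℕ.≤_) rank-q (u-last y₀∈S)
    open Shifted fv u∈S u-last u≢q

isMaxParking-sumV : (∀ h → IsParking G q h → sumV h ≤ sumV f) → IsParking G q g → sumV g ≡ sumV f
  → IsMaxParking G q g
isMaxParking-sumV maximal g-parking Σg≡Σf =
  g-parking , λ h h-parking → subst (sumV h ≤_) (≡.sym Σg≡Σf) (maximal h h-parking)

maxParking-notUnique : ∀ {k} → IsMaxParking G q f → f v ≡ +[1+ k ]
  → ∃ λ g → IsMaxParking G q g × g v ≢ f v
maxParking-notUnique {G = G} {q = q} {f = f} (parking , maximal) fv =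
  let f′ , f′-parking , Σf′≡Σf , f′v≢fv = shiftChip {G = G} parking (burningOrder parking) fv
  in f′ , isMaxParking-sumV {G = G} {q = q} {f = f} maximal f′-parking Σf′≡Σf , f′v≢fv

isParking-nonnegative : IsParking G q g → x ≢ q → 0ℤ ≤ g x
isParking-nonnegative {x = x} (_ , _ , parking) x≢q
  with parking ⁅ x ⁆ (x , x∈⁅x⁆ x) (x≢y⇒x∉⁅y⁆ (λ q≡x → x≢q (≡.sym q≡x)))
... | w , w∈⁅x⁆ , 0≤gw , _ with x∈⁅y⁆⇒x≡y x w∈⁅x⁆
...   | refl = 0≤gw

≤-isParking : (∀ v → f v ≡ minusOne ⊎ f v ≡ 0ℤ) → f q ≡ minusOne → IsParking G q g → ∀ v → f v ≤ g v
≤-isParking {q = q} {G = G} {g = g} small f-q g-parking v with small v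
... | inj₁ fv≡-1 = subst (_≤ g v) (≡.sym fv≡-1) (proj₁ g-parking v)
... | inj₂ fv≡0 = subst (_≤ g v) (≡.sym fv≡0) (isParking-nonnegative {G = G} g-parking v≢q)
  where
  v≢q : v ≢ q
  v≢q refl with trans (≡.sym fv≡0) f-q
  ... | ()

-1≤i∧¬positive⇒i≡-1⊎i≡0 : ∀ {i} → minusOne ≤ i → (∀ {k} → i ≢ +[1+ k ]) → i ≡ minusOne ⊎ i ≡ 0ℤ
-1≤i∧¬positive⇒i≡-1⊎i≡0 { -[1+ 0 ]} _ _ = inj₁ refl
-1≤i∧¬positive⇒i≡-1⊎i≡0 { -[1+ suc _ ]} (-≤- ()) _
-1≤i∧¬positive⇒i≡-1⊎i≡0 {+ 0} _ _ = inj₂ refl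
-1≤i∧¬positive⇒i≡-1⊎i≡0 {+[1+ _ ]} _ i≢+[1+k] = contradiction refl i≢+[1+k]

mainTheorem3 : {n : ℕ} (G : SimpleGraph n) → Connected G → (q : Fin n)
    → (f : Fin n → ℤ) → IsMaxParking G q f
    → (∀ (g : Fin n → ℤ) → IsMaxParking G q g → ∀ v → g v ≡ f v)
      ⇔ (∀ v → f v ≡ minusOne ⊎ f v ≡ 0ℤ)
mainTheorem3 G _ q f (parking@(_ , f-q , _) , maximal) = mk⇔ unique⇒small small⇒unique
  where
  unique⇒small : (∀ g → IsMaxParking G q g → ∀ v → g v ≡ f v) → ∀ v → f v ≡ minusOne ⊎ f v ≡ 0ℤ
  unique⇒small unique v = -1≤i∧¬positive⇒i≡-1⊎i≡0 (proj₁ parking v) λ fv →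
    let g , g-maximum , gv≢fv = maxParking-notUnique {G = G} {q = q} {f = f} (parking , maximal) fv
    in gv≢fv (unique g g-maximum v)

  small⇒unique : (∀ v → f v ≡ minusOne ⊎ f v ≡ 0ℤ) → ∀ g → IsMaxParking G q g → ∀ v → g v ≡ f v
  small⇒unique small g (g-parking , _) =
    pointwise-≤∧sumV-≥⇒≡ (≤-isParking {G = G} small f-q g-parking) (maximal g g-parking)
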